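{- Let $p$ be a prime, let $X,Y\subseteq\mathbb{Z}/p\mathbb{Z}$, let $U\subseteq Y$ and let $i\ge 1$ be an integer. If $N_{i+1}^U\neq\emptyset$, then $$N_{i+1}^U-U\subseteq N_i^{\subseteq U},$$ and in particular $$|N_{i+1}^U|\le |N_i^{\subseteq U}|-|U|+1.$$
   Context: For sets $S,T$, $S+T=\{s+t\}$ and $S-T=\{s-t\}$; $z-U=\{z-u:u\in U\}$. Write $iY=Y+\cdots+Y$ ($i$ summands). Define $N_0=X$, $N_1=(X+Y)\setminus X$, and $N_i=(X+iY)\setminus(X+(i-1)Y)$ for $i\ge 2$. For $U\subseteq Y$ and $i\ge1$, $N_i^U$ is the set of elements $z\in N_i$ such that $z-U\subseteq N_{i-1}$ and $(z-(Y\setminus U))\cap N_{i-1}=\emptyset$. Also $N_i^{\subseteq U}=\bigcup_{V\subseteq U}N_i^V$. -}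

module Defs where

open import Data.Nat using (ℕ; zero; suc; _+_; _∸_; NonZero)
open import Data.Nat.DivMod using (_mod_)
open import Data.Bool using (Bool; true; false; _∧_; _∨_; not; if_then_else_)
open import Data.Fin using (Fin; toℕ; _≟_)
open Fin
open import Data.Fin.Subset using (Subset; ⋃; _─_; _⊆_; inside; outside; ⊥)
open import Data.Fin.Subset.Properties using (_⊆?_)
open import Data.List using (List; []; _∷_; map; filter; _++_)
open import Data.Vec using (Vec; []; _∷_; lookup; tabulate)
open import Relation.Nullary.Decidable using (does)

existsF : ∀ {n} → (Fin n → Bool) → Bool
existsF {zero} f = false
existsF {suc n} f = f zero ∨ existsF (λ k → f (suc k))

forallF : ∀ {n} → (Fin n → Bool) → Bool
forallF f = not (existsF (λ k → not (f k)))

module ZpSets (p : ℕ) .{{_ : NonZero p}} where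

  _⊕_ : Fin p → Fin p → Fin p
  a ⊕ b = (toℕ a + toℕ b) mod p

  _⊖_ : Fin p → Fin p → Fin p
  a ⊖ b = (toℕ a + (p ∸ toℕ b)) mod p

  _+ₛ_ : Subset p → Subset p → Subset p
  S +ₛ T = tabulate λ z → existsF λ s → existsF λ t →
             lookup S s ∧ lookup T t ∧ does ((s ⊕ t) ≟ z)

  _-ₛ_ : Subset p → Subset p → Subset p
  S -ₛ T = tabulate λ z → existsF λ s → existsF λ t →
             lookup S s ∧ lookup T t ∧ does ((s ⊖ t) ≟ z)

  X+_Y : Subset p → ℕ → Subset p → Subset p
  X+_Y X zero Y = X
  X+_Y X (suc i) Y = (X+_Y X i Y) +ₛ Y

  N : Subset p → Subset p → ℕ → Subset p
  N X Y zero = X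
  N X Y (suc i) = X+_Y X (suc i) Y ─ X+_Y X i Y

  -- N_i^U for i ≥ 1 (N X Y U 0 is unused and set to ∅)
  NU : Subset p → Subset p → ℕ → Subset p → Subset p
  NU X Y zero U = ⊥
  NU X Y (suc i) U = tabulate λ z →
      lookup (N X Y (suc i)) z
    ∧ forallF (λ u → if lookup U u then lookup (N X Y i) (z ⊖ u) else true)
    ∧ forallF (λ y → if lookup Y y ∧ not (lookup U y)
                      then not (lookup (N X Y i) (z ⊖ y)) else true)

  allSubsets : ∀ n → List (Subset n)
  allSubsets zero = [] ∷ []
  allSubsets (suc n) = map (inside ∷_) (allSubsets n) ++ map (outside ∷_) (allSubsets n)

  NsubU : Subset p → Subset p → ℕ → Subset p → Subset p
  NsubU X Y i U = ⋃ (map (NU X Y i) (filter (_⊆? U) (allSubsets p)))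

-- Let z ∈ N_{i+1}^U and u ∈ U. Then w = z − u lies in N_i, namely in N_i^V for
-- V = {y ∈ Y : w − y ∈ N_{i−1}}. A v ∈ V outside U would make z − v = (w − v) + u an
-- element of X + iY, hence (as z ∉ X + iY) of N_i, which z ∈ N_{i+1}^U forbids; so V ⊆ U.
-- For the bound, N_i^{⊆U} ⊆ X + iY misses N_{i+1}^U, so A − U is a proper subset of ℤ/p
-- for A = N_{i+1}^U, and the Cauchy–Davenport inequality |A − B| ≥ |A| + |B| − 1 applies.
-- Cauchy–Davenport is proved by Dyson's e-transform, by induction on B.

module Submission where

open import Defs
open import Data.Bool using (Bool; true; false; T; _∧_; not; if_then_else_)
open import Data.Bool.Properties using (T-≡; T-∧; T-∨)
open import Data.Empty using (⊥-elim)
open import Data.Fin using (Fin; zero; suc; toℕ; _≟_)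
open import Data.Fin.Permutation using (Permutation′; permutation; _⟨$⟩ʳ_)
open import Data.Fin.Properties using (toℕ-fromℕ<; toℕ-injective; toℕ<n; any?)
open import Data.Fin.Subset using (Subset; inside; outside; _∈_; _∉_; _⊆_; _⊂_; _∪_; _∩_; _─_; ⋃; ⁅_⁆; ∣_∣; Nonempty)
open import Data.Fin.Subset.Induction using (Acc; acc; ⊂-wellFounded)
open import Data.Fin.Subset.Properties using (_∈?_; _⊆?_; x∈p∪q⁺; x∈p∪q⁻; x∈p∩q⁺; x∈p∩q⁻; ∉⊥; ⊥⊆; p∩q⊆p; p─q⊆p; x∈p∧x∉q⇒x∈p─q; x∈⁅y⁆⇔x≡y; ∣⁅x⁆∣≡1; p⊆q⇒∣p∣≤∣q∣; ⊆-antisym)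
open import Data.List using (List; []; _∷_; map; filter)
open import Data.List.Membership.Propositional using () renaming (_∈_ to _∈ₗ_)
open import Data.List.Membership.Propositional.Properties using (∈-map⁺; ∈-map⁻; ∈-filter⁺; ∈-++⁺ˡ; ∈-++⁺ʳ)
open import Data.List.Relation.Unary.Any using (here; there)
open import Data.Nat using (ℕ; zero; suc; _+_; _*_; _∸_; _<_; _≤_; NonZero; ≢-nonZero; >-nonZero⁻¹)
open import Data.Nat.Coprimality using (prime⇒coprime; coprime-Bézout)
open import Data.Nat.DivMod using (_%_; _mod_; m%n<n; m%n%n≡m%n; m<n⇒m%n≡m; %-distribˡ-+; %-distribˡ-*; [m+n]%n≡m%n; [m+kn]%n≡m%n; m*n%n≡0; n%n≡0)
open import Data.Nat.GCD using (module Bézout)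
open import Data.Nat.Primality using (Prime)
open import Data.Nat.Properties using (+-0-commutativeMonoid; +-suc; +-comm; +-assoc; +-identityʳ; *-assoc; *-identityʳ; *-distribˡ-+; <⇒≤; m∸n+n≡m; m+[n∸m]≡n; +-mono-≤; +-monoˡ-≤; module ≤-Reasoning)
open import Algebra.Properties.CommutativeMonoid.Sum +-0-commutativeMonoid using (sum; sum-cong-≗; sum-permute)
open import Data.Product using (∃; _×_; _,_; proj₁; proj₂)
open import Data.Sum using (inj₁; inj₂)
open import Data.Vec using ([]; _∷_; lookup; tabulate; here; there)
open import Data.Vec.Properties using (lookup∘tabulate; []=⇒lookup; lookup⇒[]=)
open import Function using (_∘_; _⇔_; mk⇔; Equivalence)
open import Relation.Binary.PropositionalEquality using (_≡_; _≢_; refl; sym; trans; cong; cong₂; subst; module ≡-Reasoning)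
open import Relation.Nullary using (Dec; yes; no; ¬_; ¬?; does)
open import Relation.Nullary.Decidable using (_×-dec_; decidable-stable)

open Equivalence using (to; from)

private
  variable
    n : ℕ

T-not : ∀ {b} → T (not b) ⇔ (¬ T b)
T-not {true} = mk⇔ ⊥-elim (λ ¬⊤ → ¬⊤ _)
T-not {false} = mk⇔ (λ _ ()) _

T-if : ∀ {b c} → T (if b then c else true) ⇔ (T b → T c)
T-if {true} = mk⇔ (λ c _ → c) (λ f → f _)
T-if {false} = mk⇔ (λ _ ()) _

T-does : ∀ {a} {A : Set a} (a? : Dec A) → T (does a?) ⇔ A
T-does (yes a) = mk⇔ (λ _ → a) _
T-does (no ¬a) = mk⇔ ⊥-elim ¬a

T-existsF : ∀ {f : Fin n → Bool} → T (existsF f) ⇔ ∃ (T ∘ f)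
T-existsF {zero} = mk⇔ (λ ()) (λ ())
T-existsF {suc n} {f} = mk⇔ witness intro
  where
  witness : T (existsF f) → ∃ (T ∘ f)
  witness t with to T-∨ t
  ... | inj₁ t₀ = zero , t₀
  ... | inj₂ t₁ with to T-existsF t₁
  ...   | x , tx = suc x , tx
  intro : ∃ (T ∘ f) → T (existsF f)
  intro (zero , t) = from T-∨ (inj₁ t)
  intro (suc x , t) = from T-∨ (inj₂ (from T-existsF (x , t)))

T-forallF : ∀ {f : Fin n → Bool} → T (forallF f) ⇔ (∀ x → T (f x))
T-forallF {f = f} = mk⇔ instantiate generalise
  where
  instantiate : T (forallF f) → ∀ x → T (f x)
  instantiate t x with f x in fx
  ... | true = _
  ... | false = to T-not t (from T-existsF (x , subst (T ∘ not) (sym fx) _))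
  generalise : (∀ x → T (f x)) → T (forallF f)
  generalise all = from T-not λ t → let x , tx = to T-existsF t in to T-not tx (all x)

∈⇔T-lookup : ∀ {x} {S : Subset n} → x ∈ S ⇔ T (lookup S x)
∈⇔T-lookup = mk⇔ (from T-≡ ∘ []=⇒lookup) (lookup⇒[]= _ _ ∘ to T-≡)

∈-tabulate : ∀ {x} {f : Fin n → Bool} → x ∈ tabulate f ⇔ T (f x)
∈-tabulate {x = x} {f} = mk⇔ (subst T (lookup∘tabulate f x) ∘ to ∈⇔T-lookup)
                             (from ∈⇔T-lookup ∘ subst T (sym (lookup∘tabulate f x)))

∈-⋃⁺ : ∀ {Ss : List (Subset n)} {S x} → S ∈ₗ Ss → x ∈ S → x ∈ ⋃ Ss
∈-⋃⁺ (here refl) x∈S = x∈p∪q⁺ (inj₁ x∈S)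
∈-⋃⁺ (there S∈Ss) x∈S = x∈p∪q⁺ (inj₂ (∈-⋃⁺ S∈Ss x∈S))

∈-⋃⁻ : ∀ (Ss : List (Subset n)) {x} → x ∈ ⋃ Ss → ∃ λ S → S ∈ₗ Ss × x ∈ S
∈-⋃⁻ [] x∈ = ⊥-elim (∉⊥ x∈)
∈-⋃⁻ (S ∷ Ss) x∈ with x∈p∪q⁻ S (⋃ Ss) x∈
... | inj₁ x∈S = S , here refl , x∈S
... | inj₂ x∈⋃ with ∈-⋃⁻ Ss x∈⋃
...   | S′ , S′∈Ss , x∈S′ = S′ , there S′∈Ss , x∈S′

image₂ : (Fin n → Fin n → Fin n) → Subset n → Subset n → Subset n
image₂ _∙_ S R = tabulate λ z → existsF λ s → existsF λ r →
                   lookup S s ∧ lookup R r ∧ does ((s ∙ r) ≟ z)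

module _ {_∙_ : Fin n → Fin n → Fin n} {S R : Subset n} where

  ∈-image₂⁺ : ∀ {s r} → s ∈ S → r ∈ R → s ∙ r ∈ image₂ _∙_ S R
  ∈-image₂⁺ {s} {r} s∈S r∈R = from ∈-tabulate (from T-existsF (s , from T-existsF (r ,
    from T-∧ (to ∈⇔T-lookup s∈S , from T-∧ (to ∈⇔T-lookup r∈R , from (T-does (s ∙ r ≟ s ∙ r)) refl)))))

  ∈-image₂⁻ : ∀ {z} → z ∈ image₂ _∙_ S R → ∃ λ s → ∃ λ r → s ∈ S × r ∈ R × s ∙ r ≡ z
  ∈-image₂⁻ z∈ with to T-existsF (to ∈-tabulate z∈)
  ... | s , ts with to T-existsF ts
  ...   | r , tr with to T-∧ tr
  ...     | s∈S , rest with to T-∧ rest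
  ...       | r∈R , s∙r≡z = s , r , from ∈⇔T-lookup s∈S , from ∈⇔T-lookup r∈R , to (T-does (_ ≟ _)) s∙r≡z

preimage : (Fin n → Fin n) → Subset n → Subset n
preimage f S = tabulate (lookup S ∘ f)

∈-preimage : ∀ {f : Fin n → Fin n} {S x} → x ∈ preimage f S ⇔ f x ∈ S
∈-preimage = mk⇔ (from ∈⇔T-lookup ∘ to ∈-tabulate) (from ∈-tabulate ∘ to ∈⇔T-lookup)

∣p∣≡sum : ∀ (S : Subset n) → ∣ S ∣ ≡ sum (λ x → if lookup S x then 1 else 0)
∣p∣≡sum [] = refl
∣p∣≡sum (inside ∷ S) = cong suc (∣p∣≡sum S)
∣p∣≡sum (outside ∷ S) = ∣p∣≡sum S

∣preimage∣≡∣p∣ : ∀ (π : Permutation′ n) (S : Subset n) → ∣ preimage (π ⟨$⟩ʳ_) S ∣ ≡ ∣ S ∣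
∣preimage∣≡∣p∣ π S = begin
  ∣ preimage (π ⟨$⟩ʳ_) S ∣
    ≡⟨ ∣p∣≡sum (preimage (π ⟨$⟩ʳ_) S) ⟩
  sum (indicator ∘ lookup (preimage (π ⟨$⟩ʳ_) S))
    ≡⟨ sum-cong-≗ (cong indicator ∘ lookup∘tabulate (lookup S ∘ (π ⟨$⟩ʳ_))) ⟩
  sum (indicator ∘ lookup S ∘ (π ⟨$⟩ʳ_))
    ≡⟨ sum-permute (indicator ∘ lookup S) π ⟨
  sum (indicator ∘ lookup S)
    ≡⟨ ∣p∣≡sum S ⟨
  ∣ S ∣
    ∎
  where
  open ≡-Reasoning
  indicator : Bool → ℕ
  indicator b = if b then 1 else 0

∣p∪q∣+∣p∩q∣≡∣p∣+∣q∣ : ∀ (S R : Subset n) → ∣ S ∪ R ∣ + ∣ S ∩ R ∣ ≡ ∣ S ∣ + ∣ R ∣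
∣p∪q∣+∣p∩q∣≡∣p∣+∣q∣ [] [] = refl
∣p∪q∣+∣p∩q∣≡∣p∣+∣q∣ (inside ∷ S) (inside ∷ R) =
  cong suc (trans (+-suc ∣ S ∪ R ∣ ∣ S ∩ R ∣)
                  (trans (cong suc (∣p∪q∣+∣p∩q∣≡∣p∣+∣q∣ S R)) (sym (+-suc ∣ S ∣ ∣ R ∣))))
∣p∪q∣+∣p∩q∣≡∣p∣+∣q∣ (inside ∷ S) (outside ∷ R) = cong suc (∣p∪q∣+∣p∩q∣≡∣p∣+∣q∣ S R)
∣p∪q∣+∣p∩q∣≡∣p∣+∣q∣ (outside ∷ S) (inside ∷ R) =
  trans (cong suc (∣p∪q∣+∣p∩q∣≡∣p∣+∣q∣ S R)) (sym (+-suc ∣ S ∣ ∣ R ∣))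
∣p∪q∣+∣p∩q∣≡∣p∣+∣q∣ (outside ∷ S) (outside ∷ R) = ∣p∪q∣+∣p∩q∣≡∣p∣+∣q∣ S R

x∈p─q⇒x∉q : ∀ (S R : Subset n) {x} → x ∈ S ─ R → x ∉ R
x∈p─q⇒x∉q (_ ∷ S) (_ ∷ R) (there x∈S─R) (there x∈R) = x∈p─q⇒x∉q S R x∈S─R x∈R

module _ {p : ℕ} .{{_ : NonZero p}} where

  open ZpSets p

  infix 4 _≡ₚ_
  _≡ₚ_ : ℕ → ℕ → Set
  m ≡ₚ n = m % p ≡ n % p

  %≡ₚ : ∀ m → m % p ≡ₚ m
  %≡ₚ m = m%n%n≡m%n m p

  +-congₚ : ∀ {m m′ n n′} → m ≡ₚ m′ → n ≡ₚ n′ → m + n ≡ₚ m′ + n′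
  +-congₚ {m} {m′} {n} {n′} m≡m′ n≡n′ = begin
    (m + n) % p               ≡⟨ %-distribˡ-+ m n p ⟩
    (m % p + n % p) % p       ≡⟨ cong₂ (λ a b → (a + b) % p) m≡m′ n≡n′ ⟩
    (m′ % p + n′ % p) % p     ≡⟨ %-distribˡ-+ m′ n′ p ⟨
    (m′ + n′) % p             ∎
    where open ≡-Reasoning

  *-congˡₚ : ∀ k {m n} → m ≡ₚ n → k * m ≡ₚ k * n
  *-congˡₚ k {m} {n} m≡n = begin
    (k * m) % p               ≡⟨ %-distribˡ-* k m p ⟩
    (k % p * (m % p)) % p     ≡⟨ cong (λ a → (k % p * a) % p) m≡n ⟩
    (k % p * (n % p)) % p     ≡⟨ %-distribˡ-* k n p ⟨
    (k * n) % p               ∎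
    where open ≡-Reasoning

  +-cancelʳ-≡ₚ : ∀ {m n} k → m + k ≡ₚ n + k → m ≡ₚ n
  +-cancelʳ-≡ₚ {m} {n} k m+k≡n+k =
    trans (sym (undo m)) (trans (+-congₚ m+k≡n+k refl) (undo n))
    where
    undo : ∀ m → m + k + (p ∸ k % p) ≡ₚ m
    undo m = begin
      (m + k + (p ∸ k % p)) % p         ≡⟨ +-congₚ (+-congₚ {m} refl (sym (%≡ₚ k))) refl ⟩
      (m + k % p + (p ∸ k % p)) % p     ≡⟨ cong (_% p) (+-assoc m (k % p) _) ⟩
      (m + (k % p + (p ∸ k % p))) % p   ≡⟨ cong (λ a → (m + a) % p) (m+[n∸m]≡n (<⇒≤ (m%n<n k p))) ⟩
      (m + p) % p                       ≡⟨ [m+n]%n≡m%n m p ⟩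
      m % p                             ∎
      where open ≡-Reasoning

  toℕ-injectiveₚ : ∀ {a b : Fin p} → toℕ a ≡ₚ toℕ b → a ≡ b
  toℕ-injectiveₚ {a} {b} a≡b = toℕ-injective (begin
    toℕ a       ≡⟨ m<n⇒m%n≡m (toℕ<n a) ⟨
    toℕ a % p   ≡⟨ a≡b ⟩
    toℕ b % p   ≡⟨ m<n⇒m%n≡m (toℕ<n b) ⟩
    toℕ b       ∎)
    where open ≡-Reasoning

  toℕ-mod : ∀ m → toℕ (m mod p) ≡ₚ m
  toℕ-mod m = trans (cong (_% p) (toℕ-fromℕ< (m%n<n m p))) (%≡ₚ m)

  mod-cong : ∀ {m n} → m ≡ₚ n → m mod p ≡ n mod p
  mod-cong {m} {n} m≡n = toℕ-injectiveₚ (trans (toℕ-mod m) (trans m≡n (sym (toℕ-mod n))))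

  toℕ-mod-toℕ : ∀ a → toℕ a mod p ≡ a
  toℕ-mod-toℕ a = toℕ-injectiveₚ (toℕ-mod (toℕ a))

  toℕ-⊕ : ∀ a b → toℕ (a ⊕ b) ≡ₚ toℕ a + toℕ b
  toℕ-⊕ a b = toℕ-mod (toℕ a + toℕ b)

  toℕ-⊖ : ∀ a b → toℕ (a ⊖ b) + toℕ b ≡ₚ toℕ a
  toℕ-⊖ a b = begin
    (toℕ (a ⊖ b) + toℕ b) % p               ≡⟨ +-congₚ (toℕ-mod (toℕ a + (p ∸ toℕ b))) refl ⟩
    (toℕ a + (p ∸ toℕ b) + toℕ b) % p       ≡⟨ cong (_% p) (+-assoc (toℕ a) _ _) ⟩
    (toℕ a + (p ∸ toℕ b + toℕ b)) % p       ≡⟨ cong (λ c → (toℕ a + c) % p) (m∸n+n≡m (<⇒≤ (toℕ<n b))) ⟩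
    (toℕ a + p) % p                         ≡⟨ [m+n]%n≡m%n (toℕ a) p ⟩
    toℕ a % p                               ∎
    where open ≡-Reasoning

  ⊕-comm : ∀ a b → a ⊕ b ≡ b ⊕ a
  ⊕-comm a b = cong (_mod p) (+-comm (toℕ a) (toℕ b))

  ⊕-assoc : ∀ a b c → (a ⊕ b) ⊕ c ≡ a ⊕ (b ⊕ c)
  ⊕-assoc a b c = toℕ-injectiveₚ (begin
    toℕ ((a ⊕ b) ⊕ c) % p           ≡⟨ trans (toℕ-⊕ (a ⊕ b) c) (+-congₚ (toℕ-⊕ a b) refl) ⟩
    (toℕ a + toℕ b + toℕ c) % p     ≡⟨ cong (_% p) (+-assoc (toℕ a) (toℕ b) (toℕ c)) ⟩
    (toℕ a + (toℕ b + toℕ c)) % p   ≡⟨ trans (+-congₚ {toℕ a} refl (sym (toℕ-⊕ b c))) (sym (toℕ-⊕ a (b ⊕ c))) ⟩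
    toℕ (a ⊕ (b ⊕ c)) % p           ∎)
    where open ≡-Reasoning

  ⊕-⊕-comm : ∀ a b c → (a ⊕ b) ⊕ c ≡ (a ⊕ c) ⊕ b
  ⊕-⊕-comm a b c = trans (⊕-assoc a b c) (trans (cong (a ⊕_) (⊕-comm b c)) (sym (⊕-assoc a c b)))

  ⊖-⊕-cancel : ∀ a b → (a ⊖ b) ⊕ b ≡ a
  ⊖-⊕-cancel a b = toℕ-injectiveₚ (trans (toℕ-⊕ (a ⊖ b) b) (toℕ-⊖ a b))

  ⊖-unique : ∀ {a b c} → c ⊕ b ≡ a → a ⊖ b ≡ c
  ⊖-unique {a} {b} {c} c⊕b≡a = toℕ-injectiveₚ (+-cancelʳ-≡ₚ (toℕ b) (begin
    (toℕ (a ⊖ b) + toℕ b) % p   ≡⟨ toℕ-⊖ a b ⟩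
    toℕ a % p                   ≡⟨ cong (λ x → toℕ x % p) c⊕b≡a ⟨
    toℕ (c ⊕ b) % p             ≡⟨ toℕ-⊕ c b ⟩
    (toℕ c + toℕ b) % p         ∎))
    where open ≡-Reasoning

  ⊕-⊖-cancel : ∀ a b → (a ⊕ b) ⊖ b ≡ a
  ⊕-⊖-cancel a b = ⊖-unique refl

  ⊖-involutive : ∀ e x → e ⊖ (e ⊖ x) ≡ x
  ⊖-involutive e x = ⊖-unique (trans (⊕-comm x (e ⊖ x)) (⊖-⊕-cancel e x))

  ⊖-⊖-comm : ∀ a b c → (a ⊖ b) ⊖ c ≡ (a ⊖ c) ⊖ b
  ⊖-⊖-comm a b c = ⊖-unique (sym (⊖-unique (begin
    (((a ⊖ c) ⊖ b) ⊕ c) ⊕ b   ≡⟨ ⊕-⊕-comm ((a ⊖ c) ⊖ b) c b ⟩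
    (((a ⊖ c) ⊖ b) ⊕ b) ⊕ c   ≡⟨ cong (_⊕ c) (⊖-⊕-cancel (a ⊖ c) b) ⟩
    (a ⊖ c) ⊕ c               ≡⟨ ⊖-⊕-cancel a c ⟩
    a                         ∎)))
    where open ≡-Reasoning

  ⊕-⊖-assoc : ∀ a b c → (a ⊕ b) ⊖ c ≡ a ⊕ (b ⊖ c)
  ⊕-⊖-assoc a b c = ⊖-unique (trans (⊕-assoc a (b ⊖ c) c) (cong (a ⊕_) (⊖-⊕-cancel b c)))

  ⊖-⊖-reflect : ∀ e x y → (e ⊖ y) ⊖ (e ⊖ x) ≡ x ⊖ y
  ⊖-⊖-reflect e x y = trans (⊖-⊖-comm e y (e ⊖ x)) (cong (_⊖ y) (⊖-involutive e x))

  ⊖-nonZero : ∀ {a b} → a ≢ b → NonZero (toℕ (a ⊖ b))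
  ⊖-nonZero {a} {b} a≢b = ≢-nonZero λ a⊖b≡0 →
    a≢b (sym (toℕ-injectiveₚ (trans (cong (λ n → (n + toℕ b) % p) (sym a⊖b≡0)) (toℕ-⊖ a b))))

  ∃-inverse : Prime p → ∀ d .{{_ : NonZero d}} → d < p → ∃ λ k → k * d ≡ₚ 1
  ∃-inverse p-prime d d<p with coprime-Bézout (prime⇒coprime p-prime d<p)
  ... | Bézout.-+ x y 1+xp≡yd = y , trans (cong (_% p) (sym 1+xp≡yd)) ([m+kn]%n≡m%n 1 x p)
  -- here y * d ≡ -1, so (p - 1) * y inverts d
  ... | Bézout.+- x y 1+yd≡xp = q * y , +-cancelʳ-≡ₚ q (begin
    (q * y * d + q) % p         ≡⟨ cong (_% p) (+-comm (q * y * d) q) ⟩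
    (q + q * y * d) % p         ≡⟨ cong (λ a → (a + q * y * d) % p) (*-identityʳ q) ⟨
    (q * 1 + q * y * d) % p     ≡⟨ cong (λ a → (q * 1 + a) % p) (*-assoc q y d) ⟩
    (q * 1 + q * (y * d)) % p   ≡⟨ cong (_% p) (*-distribˡ-+ q 1 (y * d)) ⟨
    (q * (1 + y * d)) % p       ≡⟨ cong (λ a → (q * a) % p) 1+yd≡xp ⟩
    (q * (x * p)) % p           ≡⟨ cong (_% p) (*-assoc q x p) ⟨
    (q * x * p) % p             ≡⟨ m*n%n≡0 (q * x) p ⟩
    0                           ≡⟨ n%n≡0 p ⟨
    p % p                       ≡⟨ cong (_% p) (m+[n∸m]≡n (>-nonZero⁻¹ p)) ⟨
    (1 + q) % p                 ∎)
    where
    open ≡-Reasoning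
    q : ℕ
    q = p ∸ 1

  ∈-sumset⁺ : ∀ {S R : Subset p} {s r} → s ∈ S → r ∈ R → s ⊕ r ∈ S +ₛ R
  ∈-sumset⁺ = ∈-image₂⁺ {_∙_ = _⊕_}

  ∈-sumset⁻ : ∀ (S R : Subset p) {z} → z ∈ S +ₛ R → ∃ λ s → ∃ λ r → s ∈ S × r ∈ R × s ⊕ r ≡ z
  ∈-sumset⁻ S R = ∈-image₂⁻ {_∙_ = _⊕_}

  ∈-diffset⁺ : ∀ {S R : Subset p} {s r} → s ∈ S → r ∈ R → s ⊖ r ∈ S -ₛ R
  ∈-diffset⁺ = ∈-image₂⁺ {_∙_ = _⊖_}

  ∈-diffset⁻ : ∀ (S R : Subset p) {z} → z ∈ S -ₛ R → ∃ λ s → ∃ λ r → s ∈ S × r ∈ R × s ⊖ r ≡ z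
  ∈-diffset⁻ S R = ∈-image₂⁻ {_∙_ = _⊖_}

  ⊕-closed⇒full : Prime p → ∀ {d} .{{_ : NonZero (toℕ d)}} {A : Subset p} →
                  (∀ {x} → x ∈ A → x ⊕ d ∈ A) → ∀ {a} → a ∈ A → ∀ x → x ∈ A
  ⊕-closed⇒full p-prime {d} {A} closed {a} a∈A x with ∃-inverse p-prime (toℕ d) (toℕ<n d)
  ... | k , k*d≡1 = subst (_∈ A) a+t*k*d≡x (steps (t * k) a∈A)
    where
    open ≡-Reasoning
    t : ℕ
    t = toℕ (x ⊖ a)
    steps : ∀ j {b} → b ∈ A → (toℕ b + j * toℕ d) mod p ∈ A
    steps zero {b} b∈A =
      subst (λ n → n mod p ∈ A) (sym (+-identityʳ (toℕ b))) (subst (_∈ A) (sym (toℕ-mod-toℕ b)) b∈A)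
    steps (suc j) {b} b∈A = subst (_∈ A) (mod-cong (begin
      (toℕ (b ⊕ d) + j * toℕ d) % p     ≡⟨ +-congₚ (toℕ-⊕ b d) refl ⟩
      (toℕ b + toℕ d + j * toℕ d) % p   ≡⟨ cong (_% p) (+-assoc (toℕ b) (toℕ d) _) ⟩
      (toℕ b + suc j * toℕ d) % p       ∎)) (steps j (closed b∈A))
    a+t*k*d≡x : (toℕ a + t * k * toℕ d) mod p ≡ x
    a+t*k*d≡x = trans (mod-cong (begin
      (toℕ a + t * k * toℕ d) % p     ≡⟨ cong (λ m → (toℕ a + m) % p) (*-assoc t k (toℕ d)) ⟩
      (toℕ a + t * (k * toℕ d)) % p   ≡⟨ +-congₚ {m = toℕ a} refl (*-congˡₚ t k*d≡1) ⟩
      (toℕ a + t * 1) % p             ≡⟨ cong (λ m → (toℕ a + m) % p) (*-identityʳ t) ⟩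
      (toℕ a + t) % p                 ≡⟨ cong (_% p) (+-comm (toℕ a) t) ⟩
      (t + toℕ a) % p                 ≡⟨ toℕ-⊖ x a ⟩
      toℕ x % p                       ∎)) (toℕ-mod-toℕ x)

  translation : Fin p → Permutation′ p
  translation b = permutation (_⊖ b) (_⊕ b) (λ x → ⊕-⊖-cancel x b) (λ x → ⊖-⊕-cancel x b)

  reflection : Fin p → Permutation′ p
  reflection e = permutation (e ⊖_) (e ⊖_) (⊖-involutive e) (⊖-involutive e)

  translate-⊆⇒∣p∣≤∣q∣ : ∀ {A C : Subset p} {b} → (∀ {x} → x ∈ A → x ⊖ b ∈ C) → ∣ A ∣ ≤ ∣ C ∣
  translate-⊆⇒∣p∣≤∣q∣ {A} {C} {b} A⊖b⊆C = subst (∣ A ∣ ≤_) (∣preimage∣≡∣p∣ (translation b) C)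
    (p⊆q⇒∣p∣≤∣q∣ (from (∈-preimage {f = _⊖ b}) ∘ A⊖b⊆C))

  reflect : Fin p → Subset p → Subset p
  reflect e = preimage (e ⊖_)

  ∈-reflect : ∀ {e x} (S : Subset p) → x ∈ reflect e S ⇔ e ⊖ x ∈ S
  ∈-reflect S = ∈-preimage

  module Dyson (e : Fin p) {A B : Subset p} where

    A′ B′ : Subset p
    A′ = A ∪ reflect e B
    B′ = B ∩ reflect e A

    B′≡reflect : B′ ≡ reflect e (A ∩ reflect e B)
    B′≡reflect = ⊆-antisym into onto
      where
      into : B′ ⊆ reflect e (A ∩ reflect e B)
      into x∈B′ with x∈p∩q⁻ B (reflect e A) x∈B′
      ... | x∈B , x∈eA = from (∈-reflect (A ∩ reflect e B)) (x∈p∩q⁺ (to (∈-reflect A) x∈eA ,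
                           from (∈-reflect B) (subst (_∈ B) (sym (⊖-involutive e _)) x∈B)))
      onto : reflect e (A ∩ reflect e B) ⊆ B′
      onto x∈ with x∈p∩q⁻ A (reflect e B) (to (∈-reflect (A ∩ reflect e B)) x∈)
      ... | e⊖x∈A , e⊖x∈eB = x∈p∩q⁺ (subst (_∈ B) (⊖-involutive e _) (to (∈-reflect B) e⊖x∈eB) ,
                               from (∈-reflect A) e⊖x∈A)

    ∣A′∣+∣B′∣≡∣A∣+∣B∣ : ∣ A′ ∣ + ∣ B′ ∣ ≡ ∣ A ∣ + ∣ B ∣
    ∣A′∣+∣B′∣≡∣A∣+∣B∣ = begin
      ∣ A′ ∣ + ∣ B′ ∣
        ≡⟨ cong (λ S → ∣ A′ ∣ + ∣ S ∣) B′≡reflect ⟩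
      ∣ A′ ∣ + ∣ reflect e (A ∩ reflect e B) ∣
        ≡⟨ cong (∣ A′ ∣ +_) (∣preimage∣≡∣p∣ (reflection e) (A ∩ reflect e B)) ⟩
      ∣ A′ ∣ + ∣ A ∩ reflect e B ∣
        ≡⟨ ∣p∪q∣+∣p∩q∣≡∣p∣+∣q∣ A (reflect e B) ⟩
      ∣ A ∣ + ∣ reflect e B ∣
        ≡⟨ cong (∣ A ∣ +_) (∣preimage∣≡∣p∣ (reflection e) B) ⟩
      ∣ A ∣ + ∣ B ∣
        ∎
      where open ≡-Reasoning

    A⊖B⊆C⇒A′⊖B′⊆C : ∀ {C} → (∀ {x y} → x ∈ A → y ∈ B → x ⊖ y ∈ C) →
                    ∀ {x y} → x ∈ A′ → y ∈ B′ → x ⊖ y ∈ C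
    A⊖B⊆C⇒A′⊖B′⊆C {C} A⊖B⊆C {x} {y} x∈A′ y∈B′
      with x∈p∪q⁻ A (reflect e B) x∈A′ | x∈p∩q⁻ B (reflect e A) y∈B′
    ... | inj₁ x∈A  | y∈B , _    = A⊖B⊆C x∈A y∈B
    ... | inj₂ x∈eB | _ , y∈eA   =
      subst (_∈ C) (⊖-⊖-reflect e x y) (A⊖B⊆C (to (∈-reflect A) y∈eA) (to (∈-reflect B) x∈eB))

  -- If B ≠ {b₀}, pick b₁ ∈ B − {b₀} and d = b₀ − b₁. As A ≠ ℤ/p (it misses c + b₀), A is
  -- not closed under + d (p is prime), so a′ + d ∉ A for some a′ ∈ A; with e = a′ + b₀ the transform
  -- keeps b₀ in B′ (e − b₀ = a′) and drops b₁ from it (e − b₁ = a′ + d).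
  cauchy-davenport-⊆ : Prime p → ∀ {A B C : Subset p} {a b c} → Acc _⊂_ B →
    a ∈ A → b ∈ B → c ∉ C → (∀ {x y} → x ∈ A → y ∈ B → x ⊖ y ∈ C) → ∣ A ∣ + ∣ B ∣ ≤ ∣ C ∣ + 1
  cauchy-davenport-⊆ p-prime {A} {B} {C} {b = b₀} {c} (acc smaller) a∈A b₀∈B c∉C A⊖B⊆C
    with any? (λ b → b ∈? B ×-dec ¬? (b ≟ b₀))
  ... | no ∄b₁ = +-mono-≤ (translate-⊆⇒∣p∣≤∣q∣ {b = b₀} (λ x∈A → A⊖B⊆C x∈A b₀∈B)) ∣B∣≤1
    where
    B⊆⁅b₀⁆ : B ⊆ ⁅ b₀ ⁆
    B⊆⁅b₀⁆ {b} b∈B = from x∈⁅y⁆⇔x≡y (decidable-stable (b ≟ b₀) (λ b≢b₀ → ∄b₁ (b , b∈B , b≢b₀)))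
    ∣B∣≤1 : ∣ B ∣ ≤ 1
    ∣B∣≤1 = subst (∣ B ∣ ≤_) (∣⁅x⁆∣≡1 b₀) (p⊆q⇒∣p∣≤∣q∣ B⊆⁅b₀⁆)
  ... | yes (b₁ , b₁∈B , b₁≢b₀) with any? (λ x → x ∈? A ×-dec ¬? (x ⊕ (b₀ ⊖ b₁) ∈? A))
  ...   | no ∄exit = ⊥-elim (c∉C (subst (_∈ C) (⊕-⊖-cancel c b₀) (A⊖B⊆C (A-full (c ⊕ b₀)) b₀∈B)))
    where
    A-full : ∀ x → x ∈ A
    A-full = ⊕-closed⇒full p-prime {{⊖-nonZero (b₁≢b₀ ∘ sym)}}
      (λ {x} x∈A → decidable-stable (_ ∈? A) (λ x⊕d∉A → ∄exit (x , x∈A , x⊕d∉A))) a∈A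
  ...   | yes (a′ , a′∈A , a′⊕d∉A) = subst (_≤ ∣ C ∣ + 1) ∣A′∣+∣B′∣≡∣A∣+∣B∣
      (cauchy-davenport-⊆ p-prime (smaller B′⊂B) (x∈p∪q⁺ (inj₁ a′∈A)) b₀∈B′ c∉C (A⊖B⊆C⇒A′⊖B′⊆C A⊖B⊆C))
    where
    open Dyson (a′ ⊕ b₀) {A} {B}
    b₀∈B′ : b₀ ∈ B′
    b₀∈B′ = x∈p∩q⁺ (b₀∈B , from (∈-reflect A) (subst (_∈ A) (sym (⊕-⊖-cancel a′ b₀)) a′∈A))
    b₁∉B′ : b₁ ∉ B′
    b₁∉B′ b₁∈B′ with x∈p∩q⁻ B (reflect (a′ ⊕ b₀) A) b₁∈B′
    ... | _ , b₁∈eA = a′⊕d∉A (subst (_∈ A) (⊕-⊖-assoc a′ b₀ b₁) (to (∈-reflect A) b₁∈eA))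
    B′⊂B : B′ ⊂ B
    B′⊂B = p∩q⊆p B (reflect (a′ ⊕ b₀) A) , b₁ , b₁∈B , b₁∉B′

  cauchy-davenport : Prime p → ∀ {A B : Subset p} {c} → Nonempty A → Nonempty B →
                     c ∉ A -ₛ B → ∣ A ∣ + ∣ B ∣ ≤ ∣ A -ₛ B ∣ + 1
  cauchy-davenport p-prime (_ , a∈A) (_ , b∈B) c∉A-B =
    cauchy-davenport-⊆ p-prime (⊂-wellFounded _) a∈A b∈B c∉A-B ∈-diffset⁺

  allSubsets-complete : ∀ {n} (V : Subset n) → V ∈ₗ allSubsets n
  allSubsets-complete [] = here refl
  allSubsets-complete (inside ∷ V) = ∈-++⁺ˡ (∈-map⁺ (inside ∷_) (allSubsets-complete V))
  allSubsets-complete {suc n} (outside ∷ V) =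
    ∈-++⁺ʳ (map (inside ∷_) (allSubsets n)) (∈-map⁺ (outside ∷_) (allSubsets-complete V))

  module _ (X Y : Subset p) where

    X+[_]Y : ℕ → Subset p
    X+[ i ]Y = X+_Y X i Y

    N⊆X+iY : ∀ i → N X Y i ⊆ X+[ i ]Y
    N⊆X+iY zero = λ z∈X → z∈X
    N⊆X+iY (suc i) = p─q⊆p X+[ suc i ]Y X+[ i ]Y

    ∈N-suc⇒∉X+iY : ∀ i {z} → z ∈ N X Y (suc i) → z ∉ X+[ i ]Y
    ∈N-suc⇒∉X+iY i = x∈p─q⇒x∉q X+[ suc i ]Y X+[ i ]Y

    ⊖∈X+iY⇒⊖∈N : ∀ i {z y} → z ∉ X+[ i ]Y → y ∈ Y → z ⊖ y ∈ X+[ i ]Y → z ⊖ y ∈ N X Y i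
    ⊖∈X+iY⇒⊖∈N zero _ _ z⊖y∈X = z⊖y∈X
    ⊖∈X+iY⇒⊖∈N (suc i) {z} {y} z∉X+Y y∈Y z⊖y∈X+Y = x∈p∧x∉q⇒x∈p─q z⊖y∈X+Y λ z⊖y∈X+iY →
      z∉X+Y (subst (_∈ X+[ suc i ]Y) (⊖-⊕-cancel z y) (∈-sumset⁺ z⊖y∈X+iY y∈Y))

    ∈N-suc⇒∃⊖∈N : ∀ i {z} → z ∈ N X Y (suc i) → ∃ λ y → y ∈ Y × z ⊖ y ∈ N X Y i
    ∈N-suc⇒∃⊖∈N i z∈N =
      let w , y , w∈X+iY , y∈Y , w⊕y≡z = ∈-sumset⁻ X+[ i ]Y Y (N⊆X+iY (suc i) z∈N) in
      y , y∈Y , ⊖∈X+iY⇒⊖∈N i (∈N-suc⇒∉X+iY i z∈N) y∈Y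
            (subst (_∈ X+[ i ]Y) (trans (sym (⊕-⊖-cancel w y)) (cong (_⊖ y) w⊕y≡z)) w∈X+iY)

    record InNU (i : ℕ) (U : Subset p) (z : Fin p) : Set where
      field
        z∈N : z ∈ N X Y (suc i)
        z⊖U⊆N : ∀ {u} → u ∈ U → z ⊖ u ∈ N X Y i
        z⊖[Y─U]∉N : ∀ {y} → y ∈ Y → y ∉ U → z ⊖ y ∉ N X Y i

    ∈-NU : ∀ i U {z} → z ∈ NU X Y (suc i) U ⇔ InNU i U z
    ∈-NU i U {z} = mk⇔ split assemble
      where
      inN : Bool
      inN = lookup (N X Y (suc i)) z
      below above : Fin p → Bool
      below u = if lookup U u then lookup (N X Y i) (z ⊖ u) else true
      above y = if lookup Y y ∧ not (lookup U y) then not (lookup (N X Y i) (z ⊖ y)) else true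

      y∈Y─U : ∀ {y} → y ∈ Y → y ∉ U → T (lookup Y y ∧ not (lookup U y))
      y∈Y─U {y} y∈Y y∉U =
        from (T-∧ {lookup Y y}) (to ∈⇔T-lookup y∈Y , from (T-not {lookup U y}) (y∉U ∘ from ∈⇔T-lookup))

      split : z ∈ NU X Y (suc i) U → InNU i U z
      split z∈NU = record
        { z∈N = from ∈⇔T-lookup (proj₁ t)
        ; z⊖U⊆N = λ {u} u∈U → from ∈⇔T-lookup
            (to (T-if {lookup U u}) (to (T-forallF {f = below}) (proj₁ t-forall) u) (to ∈⇔T-lookup u∈U))
        ; z⊖[Y─U]∉N = λ {y} y∈Y y∉U → to (T-not {lookup (N X Y i) (z ⊖ y)})
            (to (T-if {lookup Y y ∧ not (lookup U y)})
                (to (T-forallF {f = above}) (proj₂ t-forall) y) (y∈Y─U y∈Y y∉U))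
            ∘ to ∈⇔T-lookup
        }
        where
        t : T inN × T (forallF below ∧ forallF above)
        t = to (T-∧ {inN}) (to ∈-tabulate z∈NU)
        t-forall : T (forallF below) × T (forallF above)
        t-forall = to (T-∧ {forallF below}) (proj₂ t)

      assemble : InNU i U z → z ∈ NU X Y (suc i) U
      assemble z∈NU = from ∈-tabulate (from (T-∧ {inN}) (to ∈⇔T-lookup z∈N , from (T-∧ {forallF below})
        ( from (T-forallF {f = below}) (λ u → from (T-if {lookup U u}) (to ∈⇔T-lookup ∘ z⊖U⊆N ∘ from ∈⇔T-lookup))
        , from (T-forallF {f = above}) (λ y → from (T-if {lookup Y y ∧ not (lookup U y)}) λ t →
            let y∈Y , y∉U = to (T-∧ {lookup Y y}) t in
            from (T-not {lookup (N X Y i) (z ⊖ y)})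
              (z⊖[Y─U]∉N (from ∈⇔T-lookup y∈Y) (to (T-not {lookup U y}) y∉U ∘ to ∈⇔T-lookup) ∘ from ∈⇔T-lookup)))))
        where open InNU z∈NU

    NU⊆N : ∀ i U → NU X Y i U ⊆ N X Y i
    NU⊆N zero U = ⊥⊆
    NU⊆N (suc i) U = InNU.z∈N ∘ to (∈-NU i U)

    ∈-NsubU⁺ : ∀ i {U V z} → V ⊆ U → z ∈ NU X Y i V → z ∈ NsubU X Y i U
    ∈-NsubU⁺ i {U} {V} V⊆U =
      ∈-⋃⁺ (∈-map⁺ (NU X Y i) (∈-filter⁺ (_⊆? U) (allSubsets-complete V) V⊆U))

    NsubU⊆N : ∀ i U → NsubU X Y i U ⊆ N X Y i
    NsubU⊆N i U z∈NsubU with ∈-⋃⁻ (map (NU X Y i) (filter (_⊆? U) (allSubsets p))) z∈NsubU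
    ... | S , S∈ , z∈S with ∈-map⁻ (NU X Y i) S∈
    ...   | V , _ , refl = NU⊆N i V z∈S

    ∈NU⇒∉NsubU : ∀ i U {z} → z ∈ NU X Y (suc i) U → z ∉ NsubU X Y i U
    ∈NU⇒∉NsubU i U z∈NU z∈NsubU =
      ∈N-suc⇒∉X+iY i (InNU.z∈N (to (∈-NU i U) z∈NU)) (N⊆X+iY i (NsubU⊆N i U z∈NsubU))

    ∈NU⇒U-nonempty : ∀ i U {z} → z ∈ NU X Y (suc i) U → Nonempty U
    ∈NU⇒U-nonempty i U z∈NU =
      let y , y∈Y , z⊖y∈N = ∈N-suc⇒∃⊖∈N i z∈N in
      y , decidable-stable (y ∈? U) (λ y∉U → z⊖[Y─U]∉N y∈Y y∉U z⊖y∈N)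
      where open InNU (to (∈-NU i U) z∈NU)

    backSteps : ℕ → Fin p → Subset p
    backSteps i w = tabulate λ y → lookup Y y ∧ lookup (N X Y i) (w ⊖ y)

    ∈-backSteps : ∀ i w {y} → y ∈ backSteps i w ⇔ (y ∈ Y × w ⊖ y ∈ N X Y i)
    ∈-backSteps i w {y} = mk⇔
      (λ y∈ → let y∈Y , w⊖y∈N = to (T-∧ {lookup Y y}) (to ∈-tabulate y∈) in
              from ∈⇔T-lookup y∈Y , from ∈⇔T-lookup w⊖y∈N)
      (λ (y∈Y , w⊖y∈N) → from ∈-tabulate (from (T-∧ {lookup Y y}) (to ∈⇔T-lookup y∈Y , to ∈⇔T-lookup w⊖y∈N)))

    ∈NU-backSteps : ∀ i {w} → w ∈ N X Y (suc i) → w ∈ NU X Y (suc i) (backSteps i w)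
    ∈NU-backSteps i {w} w∈N = from (∈-NU i (backSteps i w)) record
      { z∈N = w∈N
      ; z⊖U⊆N = proj₂ ∘ to (∈-backSteps i w)
      ; z⊖[Y─U]∉N = λ y∈Y y∉ w⊖y∈N → y∉ (from (∈-backSteps i w) (y∈Y , w⊖y∈N))
      }

    backSteps⊆U : ∀ i {U z u} → U ⊆ Y → z ∈ NU X Y (suc (suc i)) U → u ∈ U → backSteps i (z ⊖ u) ⊆ U
    backSteps⊆U i {U} {z} {u} U⊆Y z∈NU u∈U {v} v∈ with v ∈? U | to (∈-backSteps i (z ⊖ u)) v∈
    ... | yes v∈U | _ = v∈U
    ... | no v∉U | v∈Y , z⊖u⊖v∈N =
      ⊥-elim (z⊖[Y─U]∉N v∈Y v∉U (⊖∈X+iY⇒⊖∈N (suc i) (∈N-suc⇒∉X+iY (suc i) z∈N) v∈Y z⊖v∈X+Y))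
      where
      open InNU (to (∈-NU (suc i) U) z∈NU)
      z⊖v∈X+Y : z ⊖ v ∈ X+[ suc i ]Y
      z⊖v∈X+Y = subst (_∈ X+[ suc i ]Y) (trans (cong (_⊕ u) (⊖-⊖-comm z u v)) (⊖-⊕-cancel (z ⊖ v) u))
                  (∈-sumset⁺ (N⊆X+iY i z⊖u⊖v∈N) (U⊆Y u∈U))

    NU-U⊆NsubU : ∀ i {U} → U ⊆ Y → NU X Y (suc (suc i)) U -ₛ U ⊆ NsubU X Y (suc i) U
    NU-U⊆NsubU i {U} U⊆Y x∈ =
      let z , u , z∈NU , u∈U , z⊖u≡x = ∈-diffset⁻ (NU X Y (suc (suc i)) U) U x∈ in
      subst (_∈ NsubU X Y (suc i) U) z⊖u≡x (∈-NsubU⁺ (suc i) (backSteps⊆U i U⊆Y z∈NU u∈U)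
        (∈NU-backSteps i (InNU.z⊖U⊆N (to (∈-NU (suc i) U) z∈NU) u∈U)))

lemma2p3 : (p : ℕ) .{{_ : NonZero p}} → Prime p → (X Y U : Subset p) → U ⊆ Y
    → (i : ℕ) → 1 ≤ i
    → Nonempty (ZpSets.NU p X Y (ℕ.suc i) U)
    → (ZpSets._-ₛ_ p (ZpSets.NU p X Y (ℕ.suc i) U) U ⊆ ZpSets.NsubU p X Y i U)
      × (∣ ZpSets.NU p X Y (ℕ.suc i) U ∣ + ∣ U ∣ ≤ ∣ ZpSets.NsubU p X Y i U ∣ + 1)
lemma2p3 p p-prime X Y U U⊆Y (suc i) _ (z , z∈NU) = inclusion , (begin
  ∣ NU X Y (suc (suc i)) U ∣ + ∣ U ∣   ≤⟨ cauchy-davenport p-prime (z , z∈NU)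
                                                (∈NU⇒U-nonempty X Y (suc i) U z∈NU)
                                                (∈NU⇒∉NsubU X Y (suc i) U z∈NU ∘ inclusion) ⟩
  ∣ NU X Y (suc (suc i)) U -ₛ U ∣ + 1  ≤⟨ +-monoˡ-≤ 1 (p⊆q⇒∣p∣≤∣q∣ inclusion) ⟩
  ∣ NsubU X Y (suc i) U ∣ + 1            ∎)
  where
  open ZpSets p
  open ≤-Reasoning
  inclusion : NU X Y (suc (suc i)) U -ₛ U ⊆ NsubU X Y (suc i) U
  inclusion = NU-U⊆NsubU X Y i U⊆Y
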